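{- Let $G$ and $H$ be graphs each of which is either a path or a cycle. Then $\zeta(G \square H) \leq 3$.
   Context: The localization game on a connected graph $G$ is played by a Cop controlling $k$ cops and a Robber. The Robber first chooses a vertex $r$, unknown to the Cop. In each turn the Cop probes a set $B=\{b_1,\dots,b_k\}$ of $k$ vertices and receives the distance vector $[d_G(r,b_1),\dots,d_G(r,b_k)]$. If the Cop can determine $r$ exactly, the Cop wins; otherwise the Robber may stay at $r$ or move to a neighbour of $r$, and the next turn begins. The Cop wins if the Robber is located after finitely many turns. The localization number $\zeta(G)$ is the least positive integer $k$ such that the Cop has a winning strategy with $k$ cops. $\square$ denotes the Cartesian product of graphs. -}

module Defs where

open import Data.Nat using (ℕ; zero; suc; _≤_; _<_)
open import Data.Fin using (Fin; toℕ)
open import Data.Vec using (Vec; lookup)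
open import Data.List using (List; []; _∷ʳ_)
open import Data.Product using (_×_; Σ; ∃; ∃-syntax; _,_)
open import Data.Sum using (_⊎_)
open import Relation.Nullary using (¬_)
open import Relation.Binary.PropositionalEquality using (_≡_)

record Graph : Set₁ where
  field
    V   : Set
    Adj : V → V → Set
open Graph public

data Walk (G : Graph) : V G → V G → ℕ → Set where
  here : ∀ {u} → Walk G u u 0
  step : ∀ {u w v n} → Adj G u w → Walk G w v n → Walk G u v (suc n)

Dist : (G : Graph) → V G → V G → ℕ → Set
Dist G u v d = Walk G u v d × (∀ d' → d' < d → ¬ Walk G u v d')

Path : ℕ → Graph
Path n = record { V = Fin n ; Adj = λ i j → (suc (toℕ i) ≡ toℕ j) ⊎ (suc (toℕ j) ≡ toℕ i) }

Cycle : ℕ → Graph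
Cycle n = record
  { V = Fin n
  ; Adj = λ i j → (suc (toℕ i) ≡ toℕ j) ⊎ (suc (toℕ j) ≡ toℕ i)
                  ⊎ (toℕ i ≡ 0 × suc (toℕ j) ≡ n) ⊎ (toℕ j ≡ 0 × suc (toℕ i) ≡ n) }

-- G is (isomorphic to, via the canonical model) a path P_n (n ≥ 1) or a cycle C_n (n ≥ 3).
IsPathOrCycle : Graph → Set₁
IsPathOrCycle G = (Σ ℕ λ n → 1 ≤ n × G ≡ Path n) ⊎ (Σ ℕ λ n → 3 ≤ n × G ≡ Cycle n)

_□_ : Graph → Graph → Graph
G □ H = record
  { V = V G × V H
  ; Adj = λ { (g , h) (g' , h') → (g ≡ g' × Adj H h h') ⊎ (Adj G g g' × h ≡ h') } }

-- Localization game with k cops.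
-- A Cop strategy maps the list of previous distance vectors (oldest first) to the next probe.
CopStrategy : Graph → ℕ → Set
CopStrategy G k = List (Vec ℕ k) → Vec (V G) k

IsTrajectory : (G : Graph) → (ℕ → V G) → Set
IsTrajectory G r = ∀ t → r (suc t) ≡ r t ⊎ Adj G (r t) (r (suc t))

Response : (G : Graph) {k : ℕ} → Vec (V G) k → V G → Vec ℕ k → Set
Response G B x δ = ∀ i → Dist G x (lookup B i) (lookup δ i)

data History (G : Graph) {k : ℕ} (σ : CopStrategy G k) (r : ℕ → V G) : ℕ → List (Vec ℕ k) → Set where
  start : History G σ r 0 []
  next  : ∀ {t h δ} → History G σ r t h → Response G (σ h) (r t) δ →
          History G σ r (suc t) (h ∷ʳ δ)

-- The Cop locates the Robber at turn t: after the responses of turns 0,…,t,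
-- every trajectory producing the same responses is at the same vertex at turn t.
LocatedAt : (G : Graph) {k : ℕ} → CopStrategy G k → (ℕ → V G) → ℕ → Set
LocatedAt G σ r t =
  ∃[ h ] (History G σ r (suc t) h ×
          (∀ r' → IsTrajectory G r' → History G σ r' (suc t) h → r' t ≡ r t))

CopWins : Graph → ℕ → Set
CopWins G k = ∃[ σ ] (∀ r → IsTrajectory G r → ∃[ t ] LocatedAt G {k} σ r t)

ζ≤ : Graph → ℕ → Set
ζ≤ G m = ∃[ k ] (1 ≤ k × k ≤ m × CopWins G k)

-- Give G □ H the distance d_G + d_H. Each factor carries three landmarks from which a vertex is
-- recovered even when all three distances are increased by a common unknown amount: the two ends of
-- a path (their distances have constant sum), and 0, 1 and an antipode c of 0 on a cycle (the sign of
-- d(i,0) − d(i,1) tells on which arc i lies, and along an arc d(i,0) + d(i,c) is constant). In the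
-- first round the cops probe (ℓₖ, m₁) for the landmarks ℓₖ of G and m₁ of H; the answers are the
-- G-distances of the robber's x shifted by d_H(y, m₁), so they determine x. The robber then moves to
-- (x', y') with x' in the closed neighbourhood of x. If some vertex a tells that neighbourhood apart
-- by distance, the cops next probe (a, mₖ): the answers are H-distances shifted by d_G(x', a), which
-- determine y', then d_G(x', a), and hence x'. Paths and cycles of length at least 4 have such
-- vertices, so by the symmetry G □ H ≅ H □ G only C₃ □ C₃ remains, where three fixed probes already
-- distinguish all nine vertices.

module Submission where

open import Defs
open import Data.Nat
open import Data.Nat.Properties
open import Data.Nat.Tactic.RingSolver using (solve-∀)
open import Data.Fin using (Fin; toℕ; fromℕ; fromℕ<)
open import Data.Fin.Patterns using (0F; 1F)
open import Data.Fin.Properties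
  using (toℕ-injective; toℕ<n; toℕ-fromℕ; toℕ-fromℕ<; any?; all?) renaming (_≟_ to _≟ᶠ_)
open import Data.Vec using (Vec; []; _∷_; lookup; map; head)
open import Data.Vec.Properties using (lookup-map; ≡-dec)
open import Data.List using ([]; _∷_)
open import Data.Product using (_×_; ∃; ∃-syntax; _,_; proj₁; proj₂; swap)
open import Data.Product.Properties using () renaming (≡-dec to ×-≡-dec)
open import Data.Sum using (_⊎_; inj₁; inj₂) renaming (swap to ⊎-swap)
open import Data.Empty using (⊥; ⊥-elim)
open import Function using (_∘_)
open import Relation.Nullary using (Dec; yes; no)
open import Relation.Nullary.Decidable using (_×-dec_; _→-dec_; from-yes)
open import Relation.Unary using (Decidable)
open import Relation.Binary.PropositionalEquality

-- Arithmetic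
cross-shift : ∀ {p q p' q' X X'} → p + X ≡ p' + X' → q + X ≡ q' + X' → p + q' ≡ p' + q
cross-shift {p} {q} {p'} {q'} {X} {X'} e₁ e₂ = +-cancelʳ-≡ (X + X') (p + q') (p' + q) (begin
  p + q' + (X + X')   ≡⟨ lemma p q' X X' ⟩
  (p + X) + (q' + X') ≡⟨ cong₂ _+_ e₁ (sym e₂) ⟩
  (p' + X') + (q + X) ≡⟨ sym (lemma p' q X' X) ⟩
  p' + q + (X' + X)   ≡⟨ cong (p' + q +_) (+-comm X' X) ⟩
  p' + q + (X + X')   ∎)
  where
  open ≡-Reasoning
  lemma : ∀ p q X X' → p + q + (X + X') ≡ (p + X) + (q + X')
  lemma = solve-∀

double-injective : ∀ {a a'} → a + a ≡ a' + a' → a ≡ a'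
double-injective {a} {a'} e = *-cancelˡ-≡ a a' 2 (begin
  2 * a        ≡⟨ cong (a +_) (+-identityʳ a) ⟩
  a + a        ≡⟨ e ⟩
  a' + a'      ≡⟨ cong (a' +_) (sym (+-identityʳ a')) ⟩
  2 * a'       ∎)
  where open ≡-Reasoning

balanced-sum : ∀ {a b a' b' s} → a + b' ≡ a' + b → a + b ≡ s → a' + b' ≡ s → a ≡ a'
balanced-sum {a} {b} {a'} {b'} {s} e sum sum' =
  double-injective (+-cancelʳ-≡ (b + b') (a + a) (a' + a') (begin
  a + a + (b + b')     ≡⟨ lemma a b b' ⟩
  (a + b) + (a + b')   ≡⟨ +-comm (a + b) (a + b') ⟩
  (a + b') + (a + b)   ≡⟨ cong₂ _+_ e (trans sum (sym sum')) ⟩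
  (a' + b) + (a' + b') ≡⟨ sym (lemma a' b b') ⟩
  a' + a' + (b + b')   ∎))
  where
  open ≡-Reasoning
  lemma : ∀ a b b' → a + a + (b + b') ≡ (a + b) + (a + b')
  lemma = solve-∀

balanced-slope : ∀ {a b a' b' e f e'} → a + b' ≡ a' + b → a + e ≡ b + f → a' + e' ≡ b' + f → e ≡ e'
balanced-slope {a} {b} {a'} {b'} {e} {f} {e'} bal slope slope' = +-cancelʳ-≡ (a + b') e e' (begin
  e + (a + b')  ≡⟨ lemma a e b' ⟩
  (a + e) + b'  ≡⟨ cong (_+ b') slope ⟩
  (b + f) + b'  ≡⟨ lemma′ b f b' ⟩
  (b' + f) + b  ≡⟨ cong (_+ b) (sym slope') ⟩
  (a' + e') + b ≡⟨ sym (lemma a' e' b) ⟩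
  e' + (a' + b) ≡⟨ cong (e' +_) (sym bal) ⟩
  e' + (a + b') ∎)
  where
  open ≡-Reasoning
  lemma : ∀ a e b → e + (a + b) ≡ (a + e) + b
  lemma = solve-∀
  lemma′ : ∀ b f b' → (b + f) + b' ≡ (b' + f) + b
  lemma′ = solve-∀

∣-∣-adjacent : ∀ {x y} → (suc x ≡ y) ⊎ (suc y ≡ x) → ∣ x - y ∣ ≡ 1
∣-∣-adjacent {x} (inj₁ refl) = trans (cong ∣ x -_∣ (+-comm 1 x)) (∣m-m+n∣≡n x 1)
∣-∣-adjacent {y = y} (inj₂ refl) = trans (∣-∣-comm (suc y) y) (∣-∣-adjacent {y} (inj₁ refl))

∣-∣-step : ∀ {x y} a → (suc x ≡ y) ⊎ (suc y ≡ x) → ∣ x - a ∣ ≤ suc ∣ y - a ∣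
∣-∣-step {x} {y} a adj =
  ≤-trans (∣-∣-triangle x y a) (≤-reflexive (cong (_+ ∣ y - a ∣) (∣-∣-adjacent adj)))

∷³-injective : ∀ {A : Set} {a b c a' b' c' : A} →
               _≡_ {A = Vec A 3} (a ∷ b ∷ c ∷ []) (a' ∷ b' ∷ c' ∷ []) →
               a ≡ a' × b ≡ b' × c ≡ c'
∷³-injective refl = refl , refl , refl

-- Walks and graph metrics
_++ᵂ_ : ∀ {G u v w m n} → Walk G u v m → Walk G v w n → Walk G u w (m + n)
here ++ᵂ q = q
step e p ++ᵂ q = step e (p ++ᵂ q)

Walk-map : ∀ {G H} (f : V G → V H) → (∀ {x y} → Adj G x y → Adj H (f x) (f y)) →
           ∀ {u v n} → Walk G u v n → Walk H (f u) (f v) n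
Walk-map f f-adj here = here
Walk-map f f-adj (step e p) = step (f-adj e) (Walk-map f f-adj p)

Walk-reverse : ∀ {G} → (∀ {x y} → Adj G x y → Adj G y x) →
               ∀ {u v n} → Walk G u v n → Walk G v u n
Walk-reverse adj-sym here = here
Walk-reverse {G} adj-sym (step {n = n} e p) =
  subst (Walk G _ _) (+-comm n 1) (Walk-reverse adj-sym p ++ᵂ step (adj-sym e) here)

Move : (G : Graph) → V G → V G → Set
Move G x y = y ≡ x ⊎ Adj G x y

Move-map : ∀ {G H} (f : V G → V H) → (∀ {x y} → Adj G x y → Adj H (f x) (f y)) →
           ∀ {x y} → Move G x y → Move H (f x) (f y)
Move-map f f-adj (inj₁ refl) = inj₁ refl
Move-map f f-adj (inj₂ e) = inj₂ (f-adj e)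

record Metric (G : Graph) : Set where
  field
    d        : V G → V G → ℕ
    d-refl   : ∀ a → d a a ≡ 0
    d-step   : ∀ {x y} a → Adj G x y → d x a ≤ suc (d y a)
    geodesic : ∀ x a → Walk G x a (d x a)

  d≤length : ∀ {x a n} → Walk G x a n → d x a ≤ n
  d≤length {a = a} here = ≤-reflexive (d-refl a)
  d≤length {a = a} (step e p) = ≤-trans (d-step a e) (s≤s (d≤length p))

  dist : ∀ x a → Dist G x a (d x a)
  dist x a = geodesic x a , λ _ n<d w → <⇒≱ n<d (d≤length w)

  dist-unique : ∀ {x a n} → Dist G x a n → n ≡ d x a
  dist-unique {x} {a} (w , minimal) =
    ≤-antisym (≮⇒≥ λ d<n → minimal _ d<n (geodesic x a)) (d≤length w)

  response : ∀ {k} → Vec (V G) k → V G → Vec ℕ k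
  response B x = map (d x) B

  response-correct : ∀ {k} (B : Vec (V G) k) x → Response G B x (response B x)
  response-correct (b ∷ B) x 0F = dist x b
  response-correct (b ∷ B) x (Data.Fin.suc i) = response-correct B x i

  response-unique : ∀ {k} {B : Vec (V G) k} {x δ} → Response G B x δ → δ ≡ response B x
  response-unique {B = []} {δ = []} R = refl
  response-unique {B = b ∷ B} {δ = _ ∷ _} R =
    cong₂ _∷_ (dist-unique (R 0F)) (response-unique (R ∘ Data.Fin.suc))

-- Two-round strategies
module TwoRound {G} (M : Metric G) {k} (B₀ : Vec (V G) k) (B₁ : Vec ℕ k → Vec (V G) k) where
  open Metric M

  strategy : CopStrategy G k
  strategy [] = B₀
  strategy (δ ∷ _) = B₁ δ

  Locates : Set
  Locates = ∀ {x x' y y'} → response B₀ x ≡ response B₀ x' → Move G x y → Move G x' y' →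
         response (B₁ (response B₀ x)) y ≡ response (B₁ (response B₀ x)) y' → y ≡ y'

  wins : Locates → CopWins G k
  wins locates = strategy , λ r r-traj →
    1 , _ , next (next start (response-correct B₀ (r 0))) (response-correct (B₁ (δ₀ r)) (r 1)) ,
    λ r' r'-traj history → located r r-traj r'-traj history refl
    where
    δ₀ : (ℕ → V G) → Vec ℕ k
    δ₀ r = response B₀ (r 0)
    located : ∀ r {r' h} → IsTrajectory G r → IsTrajectory G r' → History G strategy r' 2 h →
              h ≡ δ₀ r ∷ response (B₁ (δ₀ r)) (r 1) ∷ [] → r' 1 ≡ r 1
    located r r-traj r'-traj (next (next start R₀) R₁) refl =
      sym (locates (response-unique R₀) (r-traj 0) (r'-traj 0) (response-unique R₁))

record _≅_ (G H : Graph) : Set where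
  field
    to       : V G → V H
    from     : V H → V G
    to-adj   : ∀ {x y} → Adj G x y → Adj H (to x) (to y)
    from-adj : ∀ {x y} → Adj H x y → Adj G (from x) (from y)
    from-to  : ∀ x → from (to x) ≡ x
    to-from  : ∀ y → to (from y) ≡ y

≅-sym : ∀ {G H} → G ≅ H → H ≅ G
≅-sym e = record { to = from ; from = to ; to-adj = from-adj ; from-adj = to-adj
                 ; from-to = to-from ; to-from = from-to }
  where open _≅_ e

□-comm : ∀ {G H} → (G □ H) ≅ (H □ G)
□-comm {G} {H} = record
  { to = swap ; from = swap ; to-adj = swap-adj {G} {H} ; from-adj = swap-adj {H} {G}
  ; from-to = λ _ → refl ; to-from = λ _ → refl }
  where
  swap-adj : ∀ {G H x y} → Adj (G □ H) x y → Adj (H □ G) (swap x) (swap y)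
  swap-adj (inj₁ (e , a)) = inj₂ (a , e)
  swap-adj (inj₂ (a , e)) = inj₁ (e , a)

module _ {G H} (e : G ≅ H) where
  open _≅_ e

  Dist-≅ : ∀ {x y n} → Dist G x y n → Dist H (to x) (to y) n
  Dist-≅ {x} {y} (w , minimal) = Walk-map to to-adj w , λ m m<n w' →
    minimal m m<n (subst₂ (λ u v → Walk G u v m) (from-to x) (from-to y) (Walk-map from from-adj w'))

module _ {G H} (e : G ≅ H) {k} (σ : CopStrategy G k) where
  open _≅_ e

  σ-≅ : CopStrategy H k
  σ-≅ = map to ∘ σ

  Response-to : ∀ {x} (B : Vec (V G) k) δ → Response G B x δ → Response H (map to B) (to x) δ
  Response-to B δ R i rewrite lookup-map i to B = Dist-≅ e (R i)

  Response-from : ∀ {y} (B : Vec (V G) k) δ → Response H (map to B) y δ → Response G B (from y) δ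
  Response-from B δ R i =
    subst (λ b → Dist G _ b _) (from-to (lookup B i))
          (Dist-≅ (≅-sym e) (subst (λ b → Dist H _ b _) (lookup-map i to B) (R i)))

  History-to : ∀ {r t h} → History G σ r t h → History H σ-≅ (to ∘ r) t h
  History-to start = start
  History-to (next {h = h} {δ} hist R) = next (History-to hist) (Response-to (σ h) δ R)

  History-from : ∀ {r t h} → History H σ-≅ r t h → History G σ (from ∘ r) t h
  History-from start = start
  History-from (next {h = h} {δ} hist R) = next (History-from hist) (Response-from (σ h) δ R)

  History-cong : ∀ {r r' t h} → (∀ s → r s ≡ r' s) → History H σ-≅ r t h → History H σ-≅ r' t h
  History-cong r≗r' start = start
  History-cong r≗r' (next {t} {h} {δ} hist R) =
    next (History-cong r≗r' hist) (subst (λ x → Response H (σ-≅ h) x δ) (r≗r' t) R)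

CopWins-≅ : ∀ {G H k} → G ≅ H → CopWins G k → CopWins H k
CopWins-≅ {G} {H} e (σ , σ-wins) =
  σ-≅ e σ , λ r' r'-traj → located r' r'-traj (σ-wins (from ∘ r') (from-traj r'-traj))
  where
  open _≅_ e
  from-traj : ∀ {r'} → IsTrajectory H r' → IsTrajectory G (from ∘ r')
  from-traj traj t = Move-map {H} {G} from from-adj (traj t)
  located : ∀ r' → IsTrajectory H r' →
            ∃[ t ] LocatedAt G σ (from ∘ r') t → ∃[ t ] LocatedAt H (σ-≅ e σ) r' t
  located r' _ (t , h , hist , unique) =
    t , h , History-cong e σ (to-from ∘ r') (History-to e σ hist) ,
    λ r'' r''-traj hist'' → trans (sym (to-from (r'' t))) (trans
      (cong to (unique (from ∘ r'') (from-traj r''-traj) (History-from e σ hist''))) (to-from (r' t)))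

□-metric : ∀ {G H} → Metric G → Metric H → Metric (G □ H)
□-metric {G} {H} MG MH = record { d = d ; d-refl = d-refl ; d-step = d-step ; geodesic = geodesic }
  where
  module MG = Metric MG
  module MH = Metric MH
  d : V (G □ H) → V (G □ H) → ℕ
  d (x , y) (a , b) = MG.d x a + MH.d y b
  d-refl : ∀ a → d a a ≡ 0
  d-refl (a , b) = cong₂ _+_ (MG.d-refl a) (MH.d-refl b)
  d-step : ∀ {x y} a → Adj (G □ H) x y → d x a ≤ suc (d y a)
  d-step {x , y} {_ , y'} (a , b) (inj₁ (refl , e)) =
    ≤-trans (+-monoʳ-≤ (MG.d x a) (MH.d-step b e)) (≤-reflexive (+-suc (MG.d x a) (MH.d y' b)))
  d-step {_ , y} (a , b) (inj₂ (e , refl)) = +-monoˡ-≤ (MH.d y b) (MG.d-step a e)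
  geodesic : ∀ x a → Walk (G □ H) x a (d x a)
  geodesic (x , y) (a , b) =
    Walk-map (_, y) (λ e → inj₂ (e , refl)) (MG.geodesic x a) ++ᵂ
    Walk-map (a ,_) (λ e → inj₁ (refl , e)) (MH.geodesic y b)

Move-□ˡ : ∀ {G H x y x' y'} → Move (G □ H) (x , y) (x' , y') → Move G x x'
Move-□ˡ (inj₁ refl) = inj₁ refl
Move-□ˡ (inj₂ (inj₁ (refl , _))) = inj₁ refl
Move-□ˡ (inj₂ (inj₂ (e , _))) = inj₂ e

-- Shift resolvers and separating vertices
Balanced : ∀ {G} → Metric G → V G → V G → V G → V G → Set
Balanced M x x' a b = d x a + d x' b ≡ d x' a + d x b
  where open Metric M

record ShiftResolver {G} (M : Metric G) : Set where
  open Metric M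
  field
    ℓ₁ ℓ₂ ℓ₃ : V G
    resolves : ∀ {x x'} → Balanced M x x' ℓ₁ ℓ₂ → Balanced M x x' ℓ₁ ℓ₃ → x ≡ x'

  shifted : V G → ℕ → Vec ℕ 3
  shifted x X = (d x ℓ₁ + X) ∷ (d x ℓ₂ + X) ∷ (d x ℓ₃ + X) ∷ []

  shifted-injective : ∀ {x x' X X'} → shifted x X ≡ shifted x' X' → x ≡ x'
  shifted-injective {x} {x'} e with ∷³-injective e
  ... | e₁ , e₂ , e₃ =
    resolves (cross-shift {d x ℓ₁} {d x ℓ₂} e₁ e₂) (cross-shift {d x ℓ₁} {d x ℓ₃} e₁ e₃)

Searchable : Set → Set₁
Searchable A = ∀ {P : A → Set} → Decidable P → Dec (∃ P)

module Locate {G} {M : Metric G} (R : ShiftResolver M) (search : Searchable (V G)) where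
  open Metric M
  open ShiftResolver R

  ShiftOf : Vec ℕ 3 → V G → Set
  ShiftOf δ x = d x ℓ₁ ≤ head δ × shifted x (head δ ∸ d x ℓ₁) ≡ δ

  shiftOf? : ∀ δ → Decidable (ShiftOf δ)
  shiftOf? δ x = (d x ℓ₁ ≤? head δ) ×-dec ≡-dec _≟_ (shifted x (head δ ∸ d x ℓ₁)) δ

  locate : Vec ℕ 3 → V G
  locate δ with search (shiftOf? δ)
  ... | yes (x , _) = x
  ... | no _ = ℓ₁

  locate-shifted : ∀ x X → locate (shifted x X) ≡ x
  locate-shifted x X with search (shiftOf? (shifted x X))
  ... | yes (x' , _ , e) = shifted-injective e
  ... | no none = ⊥-elim (none (x , m≤m+n (d x ℓ₁) X , cong (shifted x) (m+n∸m≡n (d x ℓ₁) X)))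

Separating : ∀ {G} → Metric G → Set
Separating {G} M = ∀ x → ∃[ a ] (∀ {y y'} → Move G x y → Move G x y' → d y a ≡ d y' a → y ≡ y')
  where open Metric M

record Neighbourhood {G} (M : Metric G) (x : V G) : Set where
  open Metric M
  field
    below above : V G
    d-below : d x below ≡ 1
    d-above : d above below ≡ 2
    cover   : ∀ {y} → Move G x y → y ≡ below ⊎ y ≡ x ⊎ y ≡ above

separating-from-neighbourhoods : ∀ {G} {M : Metric G} → (∀ x → Neighbourhood M x) → Separating M
separating-from-neighbourhoods {G} {M} N x =
  below , λ mv mv' e → trans (sym (read-d mv)) (trans (cong read e) (read-d mv'))
  where
  open Metric M
  open Neighbourhood (N x)
  read : ℕ → V G
  read 0 = below
  read 1 = x
  read _ = above
  read-d : ∀ {y} → Move G x y → read (d y below) ≡ y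
  read-d mv with cover mv
  ... | inj₁ refl rewrite d-refl below = refl
  ... | inj₂ (inj₁ refl) rewrite d-below = refl
  ... | inj₂ (inj₂ refl) rewrite d-above = refl

□-wins : ∀ {G H} {MG : Metric G} {MH : Metric H} → ShiftResolver MG → ShiftResolver MH →
         Searchable (V G) → Separating MG → CopWins (G □ H) 3
□-wins {G} {H} {MG} {MH} RG RH searchG sepG = TwoRound.wins M B₀ B₁ locates
  where
  module MG = Metric MG
  module MH = Metric MH
  module RG = ShiftResolver RG
  module RH = ShiftResolver RH
  open Locate RG searchG
  M = □-metric MG MH
  open Metric M using (response)

  separator : V G → V G
  separator x = proj₁ (sepG x)

  B₀ : Vec (V (G □ H)) 3
  B₀ = (RG.ℓ₁ , RH.ℓ₁) ∷ (RG.ℓ₂ , RH.ℓ₁) ∷ (RG.ℓ₃ , RH.ℓ₁) ∷ []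

  column : V G → Vec (V (G □ H)) 3
  column a = (a , RH.ℓ₁) ∷ (a , RH.ℓ₂) ∷ (a , RH.ℓ₃) ∷ []

  B₁ : Vec ℕ 3 → Vec (V (G □ H)) 3
  B₁ δ = column (separator (locate δ))

  column-response : ∀ a y₁ y₂ → response (column a) (y₁ , y₂) ≡ RH.shifted y₂ (MG.d y₁ a)
  column-response a y₁ y₂ =
    cong₂ _∷_ (+-comm (MG.d y₁ a) _)
      (cong₂ _∷_ (+-comm (MG.d y₁ a) _) (cong (_∷ []) (+-comm (MG.d y₁ a) _)))

  locates : TwoRound.Locates M B₀ B₁
  locates {i , j} {i' , j'} {y₁ , y₂} {y₁' , y₂'} e₀ mv mv' e₁ = cong₂ _,_ y₁≡y₁' y₂≡y₂'
    where
    located : locate (response B₀ (i , j)) ≡ i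
    located = locate-shifted i (MH.d j RH.ℓ₁)
    i≡i' : i ≡ i'
    i≡i' = RG.shifted-injective e₀
    a = separator (locate (response B₀ (i , j)))
    y₂≡y₂' : y₂ ≡ y₂'
    y₂≡y₂' = RH.shifted-injective
      (trans (sym (column-response a y₁ y₂)) (trans e₁ (column-response a y₁' y₂')))
    same-distance : MG.d y₁ a ≡ MG.d y₁' a
    same-distance = +-cancelʳ-≡ (MH.d y₂ RH.ℓ₁) _ _
      (trans (proj₁ (∷³-injective e₁)) (cong (λ z → MG.d y₁' a + MH.d z RH.ℓ₁) (sym y₂≡y₂')))
    y₁≡y₁' : y₁ ≡ y₁'
    y₁≡y₁' = proj₂ (sepG _)
      (subst (λ z → Move G z y₁) (sym located) (Move-□ˡ {G} {H} mv))
      (subst (λ z → Move G z y₁') (sym (trans located i≡i')) (Move-□ˡ {G} {H} mv'))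
      same-distance

-- Paths
module Paths (n′ : ℕ) where
  n = suc n′

  path-sym : ∀ {x y} → Adj (Path n) x y → Adj (Path n) y x
  path-sym (inj₁ e) = inj₂ e
  path-sym (inj₂ e) = inj₁ e

  ascending : ∀ k {i a : Fin n} → toℕ i + k ≡ toℕ a → Walk (Path n) i a k
  ascending zero {i} eq =
    subst (λ v → Walk (Path n) i v 0) (toℕ-injective (trans (sym (+-identityʳ (toℕ i))) eq)) here
  ascending (suc k) {i} {a} eq = step (inj₁ (sym (toℕ-fromℕ< i+1<n)))
    (ascending k (trans (cong (_+ k) (toℕ-fromℕ< i+1<n)) (trans (sym (+-suc (toℕ i) k)) eq)))
    where
    i+1<n : suc (toℕ i) < n
    i+1<n = ≤-<-trans (≤-trans (s≤s (m≤m+n (toℕ i) k)) (≤-reflexive (trans (sym (+-suc (toℕ i) k)) eq)))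
                      (toℕ<n a)

  line-walk : ∀ i a → Walk (Path n) i a ∣ toℕ i - toℕ a ∣
  line-walk i a with ≤-total (toℕ i) (toℕ a)
  ... | inj₁ i≤a = subst (Walk (Path n) i a) (sym (m≤n⇒∣m-n∣≡n∸m i≤a))
                         (ascending _ (m+[n∸m]≡n i≤a))
  ... | inj₂ a≤i = subst (Walk (Path n) i a) (sym (m≤n⇒∣n-m∣≡n∸m a≤i))
                         (Walk-reverse path-sym (ascending _ (m+[n∸m]≡n a≤i)))

  metric : Metric (Path n)
  metric = record { d = λ i a → ∣ toℕ i - toℕ a ∣ ; d-refl = λ a → ∣n-n∣≡0 (toℕ a)
                  ; d-step = λ a → ∣-∣-step (toℕ a) ; geodesic = line-walk }
  open Metric metric using (d)

  d-to-end : ∀ x → d x 0F + d x (fromℕ n′) ≡ n′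
  d-to-end x = trans (cong₂ _+_ (∣-∣-identityʳ (toℕ x)) d-last) (m+[n∸m]≡n x≤n′)
    where
    x≤n′ : toℕ x ≤ n′
    x≤n′ = s≤s⁻¹ (toℕ<n x)
    d-last : d x (fromℕ n′) ≡ n′ ∸ toℕ x
    d-last = trans (cong ∣ toℕ x -_∣ (toℕ-fromℕ n′)) (m≤n⇒∣m-n∣≡n∸m x≤n′)

  d-to-start-injective : ∀ {x x'} → d x 0F ≡ d x' 0F → x ≡ x'
  d-to-start-injective {x} {x'} e =
    toℕ-injective (trans (sym (∣-∣-identityʳ (toℕ x))) (trans e (∣-∣-identityʳ (toℕ x'))))

  -- ℓ₃ repeats ℓ₁: the two ends of a path already resolve up to a shift.
  resolver : ShiftResolver metric
  resolver = record { ℓ₁ = 0F ; ℓ₂ = fromℕ n′ ; ℓ₃ = 0F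
                    ; resolves = λ {x} {x'} b _ →
                        d-to-start-injective (balanced-sum b (d-to-end x) (d-to-end x')) }

  separating : Separating metric
  separating _ = 0F , λ _ _ → d-to-start-injective

-- Cycles
module Cycles (n′ : ℕ) where
  n = suc n′
  C = Cycle n

  cycle-sym : ∀ {x y} → Adj C x y → Adj C y x
  cycle-sym (inj₁ e) = inj₂ (inj₁ e)
  cycle-sym (inj₂ (inj₁ e)) = inj₁ e
  cycle-sym (inj₂ (inj₂ (inj₁ e))) = inj₂ (inj₂ (inj₂ e))
  cycle-sym (inj₂ (inj₂ (inj₂ e))) = inj₂ (inj₂ (inj₁ e))

  path⊆cycle : ∀ {x y} → Adj (Path n) x y → Adj C x y
  path⊆cycle (inj₁ e) = inj₁ e
  path⊆cycle (inj₂ e) = inj₂ (inj₁ e)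

  line-walk : ∀ i a → Walk C i a ∣ toℕ i - toℕ a ∣
  line-walk i a = Walk-map (λ x → x) path⊆cycle (Paths.line-walk n′ i a)

  last : Fin n
  last = fromℕ n′

  around-length : ∀ {i a} → i ≤ a → a ≤ n′ → i + suc (n′ ∸ a) ≡ n ∸ (a ∸ i)
  around-length {i} {a} i≤a a≤n′ = trans (sym (m+n∸n≡m _ (a ∸ i))) (cong (_∸ (a ∸ i)) total)
    where
    open ≡-Reasoning
    rearrange : ∀ x y z → x + suc y + z ≡ suc (x + z + y)
    rearrange = solve-∀
    total : i + suc (n′ ∸ a) + (a ∸ i) ≡ n
    total = begin
      i + suc (n′ ∸ a) + (a ∸ i)   ≡⟨ rearrange i (n′ ∸ a) (a ∸ i) ⟩
      suc (i + (a ∸ i) + (n′ ∸ a)) ≡⟨ cong (λ z → suc (z + (n′ ∸ a))) (m+[n∸m]≡n i≤a) ⟩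
      suc (a + (n′ ∸ a))           ≡⟨ cong suc (m+[n∸m]≡n a≤n′) ⟩
      n                            ∎

  around-walk : ∀ {i a} → toℕ i ≤ toℕ a → Walk C i a (n ∸ (toℕ a ∸ toℕ i))
  around-walk {i} {a} i≤a =
    subst (Walk C i a) length (line-walk i 0F ++ᵂ step wrap (line-walk last a))
    where
    wrap : Adj C 0F last
    wrap = inj₂ (inj₂ (inj₁ (refl , cong suc (toℕ-fromℕ n′))))
    a≤n′ : toℕ a ≤ n′
    a≤n′ = s≤s⁻¹ (toℕ<n a)
    length : ∣ toℕ i - 0 ∣ + suc ∣ toℕ last - toℕ a ∣ ≡ n ∸ (toℕ a ∸ toℕ i)
    length = trans (cong₂ (λ u v → u + suc v) (∣-∣-identityʳ (toℕ i))
                     (trans (cong ∣_- toℕ a ∣ (toℕ-fromℕ n′)) (m≤n⇒∣n-m∣≡n∸m a≤n′)))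
                   (around-length i≤a a≤n′)

  around : ∀ i a → Walk C i a (n ∸ ∣ toℕ i - toℕ a ∣)
  around i a with ≤-total (toℕ i) (toℕ a)
  ... | inj₁ i≤a = subst (λ k → Walk C i a (n ∸ k)) (sym (m≤n⇒∣m-n∣≡n∸m i≤a)) (around-walk i≤a)
  ... | inj₂ a≤i = subst (λ k → Walk C i a (n ∸ k)) (sym (m≤n⇒∣n-m∣≡n∸m a≤i))
                         (Walk-reverse cycle-sym (around-walk a≤i))

  cyclic : ℕ → ℕ
  cyclic k = k ⊓ (n ∸ k)

  cyclic-small : ∀ k → k + k ≤ n → cyclic k ≡ k
  cyclic-small k le = m≤n⇒m⊓n≡m (m+n≤o⇒m≤o∸n k le)

  cyclic-large : ∀ k → n ≤ k + k → cyclic k ≡ n ∸ k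
  cyclic-large k le = m≥n⇒m⊓n≡n (m≤n+o⇒m∸n≤o n k le)

  cyclic-sym : ∀ {k} → k ≤ n → cyclic (n ∸ k) ≡ cyclic k
  cyclic-sym {k} k≤n = trans (cong ((n ∸ k) ⊓_) (m∸[m∸n]≡n k≤n)) (⊓-comm (n ∸ k) k)

  cyclic-step : ∀ {k k'} → k ≤ suc k' → k' ≤ suc k → k' ≤ n → cyclic k ≤ suc (cyclic k')
  cyclic-step k≤k'+1 k'≤k+1 k'≤n =
    ⊓-mono-≤ k≤k'+1 (≤-trans (∸-monoʳ-≤ (suc n) k'≤k+1) (≤-reflexive (+-∸-assoc 1 k'≤n)))

  d : Fin n → Fin n → ℕ
  d i a = cyclic ∣ toℕ i - toℕ a ∣

  d-at : ∀ {i a v w} → toℕ i ≡ v → toℕ a ≡ w → d i a ≡ cyclic ∣ v - w ∣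
  d-at = cong₂ (λ v w → cyclic ∣ v - w ∣)

  d-sym : ∀ i a → d i a ≡ d a i
  d-sym i a = cong cyclic (∣-∣-comm (toℕ i) (toℕ a))

  d-from-last : ∀ {y} a → toℕ y ≡ n′ → d y a ≡ cyclic (suc (toℕ a))
  d-from-last a y≡n′ = trans (d-at y≡n′ refl)
    (trans (cong cyclic (m≤n⇒∣n-m∣≡n∸m (s≤s⁻¹ (toℕ<n a)))) (cyclic-sym (toℕ<n a)))

  ∣-∣≤n : ∀ (i a : Fin n) → ∣ toℕ i - toℕ a ∣ ≤ n
  ∣-∣≤n i a = ≤-trans (∣m-n∣≤m⊔n (toℕ i) (toℕ a)) (⊔-lub (<⇒≤ (toℕ<n i)) (<⇒≤ (toℕ<n a)))

  line-step : ∀ {x y} a → (suc (toℕ x) ≡ toℕ y) ⊎ (suc (toℕ y) ≡ toℕ x) → d x a ≤ suc (d y a)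
  line-step {x} {y} a adj =
    cyclic-step (∣-∣-step (toℕ a) adj) (∣-∣-step (toℕ a) (⊎-swap adj)) (∣-∣≤n y a)

  d-step : ∀ {x y} a → Adj C x y → d x a ≤ suc (d y a)
  d-step a (inj₁ e) = line-step a (inj₁ e)
  d-step a (inj₂ (inj₁ e)) = line-step a (inj₂ e)
  d-step {x} {y} a (inj₂ (inj₂ (inj₁ (x≡0 , y+1≡n)))) = begin
    d x a                      ≡⟨ d-at x≡0 refl ⟩
    cyclic (toℕ a)             ≤⟨ cyclic-step (m≤n⇒m≤1+n (n≤1+n _)) ≤-refl (toℕ<n a) ⟩
    suc (cyclic (suc (toℕ a))) ≡⟨ cong suc (sym (d-from-last a (suc-injective y+1≡n))) ⟩
    suc (d y a)                ∎
    where open ≤-Reasoning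
  d-step {x} {y} a (inj₂ (inj₂ (inj₂ (y≡0 , x+1≡n)))) = begin
    d x a                ≡⟨ d-from-last a (suc-injective x+1≡n) ⟩
    cyclic (suc (toℕ a)) ≤⟨ cyclic-step ≤-refl (m≤n⇒m≤1+n (n≤1+n _)) (<⇒≤ (toℕ<n a)) ⟩
    suc (cyclic (toℕ a)) ≡⟨ cong suc (sym (d-at y≡0 refl)) ⟩
    suc (d y a)          ∎
    where open ≤-Reasoning

  geodesic : ∀ i a → Walk C i a (d i a)
  geodesic i a with ∣ toℕ i - toℕ a ∣ ≤? n ∸ ∣ toℕ i - toℕ a ∣
  ... | yes short = subst (Walk C i a) (sym (m≤n⇒m⊓n≡m short)) (line-walk i a)
  ... | no long = subst (Walk C i a) (sym (m≥n⇒m⊓n≡n (<⇒≤ (≰⇒> long)))) (around i a)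

  metric : Metric C
  metric = record { d = d ; d-refl = λ a → cong cyclic (∣n-n∣≡0 (toℕ a))
                  ; d-step = d-step ; geodesic = geodesic }

  module _ (3≤n′ : 3 ≤ n′) where
    private
      1<n : 1 < n
      1<n = s≤s (≤-trans (s≤s z≤n) 3≤n′)

      cyclic-1 : cyclic 1 ≡ 1
      cyclic-1 = cyclic-small 1 1<n

      cyclic-2 : cyclic 2 ≡ 2
      cyclic-2 = cyclic-small 2 (s≤s 3≤n′)

      d-successor : ∀ {x y k} → toℕ x ≡ suc k → toℕ y ≡ k → d x y ≡ 1
      d-successor {k = k} x≡k+1 y≡k =
        trans (d-at x≡k+1 y≡k) (trans (cong cyclic (∣-∣-adjacent {suc k} (inj₂ refl))) cyclic-1)

      origin-neighbourhood : ∀ {x} → toℕ x ≡ 0 → Neighbourhood metric x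
      origin-neighbourhood {x} x≡0 = record
        { below = last ; above = one
        ; d-below = trans (d-at x≡0 (toℕ-fromℕ n′)) (trans (cyclic-sym {1} (s≤s z≤n)) cyclic-1)
        ; d-above = trans (d-sym one last) (trans (d-from-last one (toℕ-fromℕ n′))
                            (trans (cong (cyclic ∘ suc) (toℕ-fromℕ< 1<n)) cyclic-2))
        ; cover = cover }
        where
        one : Fin n
        one = fromℕ< 1<n
        cover : ∀ {y} → Move C x y → y ≡ last ⊎ y ≡ x ⊎ y ≡ one
        cover (inj₁ y≡x) = inj₂ (inj₁ y≡x)
        cover (inj₂ (inj₁ x+1≡y)) =
          inj₂ (inj₂ (toℕ-injective (trans (sym x+1≡y) (trans (cong suc x≡0) (sym (toℕ-fromℕ< 1<n))))))
        cover (inj₂ (inj₂ (inj₁ y+1≡x))) with trans y+1≡x x≡0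
        ... | ()
        cover (inj₂ (inj₂ (inj₂ (inj₁ (_ , y+1≡n))))) =
          inj₁ (toℕ-injective (trans (suc-injective y+1≡n) (sym (toℕ-fromℕ n′))))
        cover (inj₂ (inj₂ (inj₂ (inj₂ (_ , x+1≡n))))) =
          ⊥-elim (<⇒≱ 3≤n′ (≤-trans (≤-reflexive n′≡0) z≤n))
          where
          n′≡0 : n′ ≡ 0
          n′≡0 = sym (suc-injective (trans (cong suc (sym x≡0)) x+1≡n))

      last-neighbourhood : ∀ {x k} → toℕ x ≡ suc k → suc k ≡ n′ → Neighbourhood metric x
      last-neighbourhood {x} {k} x≡k+1 k+1≡n′ = record
        { below = previous ; above = 0F
        ; d-below = d-successor x≡k+1 (toℕ-fromℕ< k<n)
        ; d-above = trans (d-at {0F} refl (toℕ-fromℕ< k<n))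
                          (trans (cong (cyclic ∘ (_∸ 1)) k+1≡n′) (trans (cyclic-sym 1<n) cyclic-2))
        ; cover = cover }
        where
        k<n : k < n
        k<n = ≤-trans (n≤1+n (suc k)) (s≤s (≤-reflexive k+1≡n′))
        previous : Fin n
        previous = fromℕ< k<n
        cover : ∀ {y} → Move C x y → y ≡ previous ⊎ y ≡ x ⊎ y ≡ 0F
        cover (inj₁ y≡x) = inj₂ (inj₁ y≡x)
        cover {y} (inj₂ (inj₁ x+1≡y)) =
          ⊥-elim (<-irrefl (trans (sym x+1≡y) (cong suc (trans x≡k+1 k+1≡n′))) (toℕ<n y))
        cover (inj₂ (inj₂ (inj₁ y+1≡x))) =
          inj₁ (toℕ-injective (trans (suc-injective (trans y+1≡x x≡k+1)) (sym (toℕ-fromℕ< k<n))))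
        cover (inj₂ (inj₂ (inj₂ (inj₁ (x≡0 , _))))) with trans (sym x≡k+1) x≡0
        ... | ()
        cover (inj₂ (inj₂ (inj₂ (inj₂ (y≡0 , _))))) = inj₂ (inj₂ (toℕ-injective y≡0))

      inner-neighbourhood : ∀ {x k} → toℕ x ≡ suc k → suc k ≢ n′ → Neighbourhood metric x
      inner-neighbourhood {x} {k} x≡k+1 k+1≢n′ = record
        { below = previous ; above = following
        ; d-below = d-successor x≡k+1 (toℕ-fromℕ< k<n)
        ; d-above = trans (d-at (toℕ-fromℕ< k+2<n) (toℕ-fromℕ< k<n))
                          (trans (cong cyclic k+2-k≡2) cyclic-2)
        ; cover = cover }
        where
        k+1<n′ : suc k < n′
        k+1<n′ = ≤∧≢⇒< (s≤s⁻¹ (subst (_< n) x≡k+1 (toℕ<n x))) k+1≢n′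
        k<n : k < n
        k<n = <⇒≤ (subst (_< n) x≡k+1 (toℕ<n x))
        k+2<n : suc (suc k) < n
        k+2<n = s≤s k+1<n′
        previous following : Fin n
        previous = fromℕ< k<n
        following = fromℕ< k+2<n
        k+2-k≡2 : ∣ suc (suc k) - k ∣ ≡ 2
        k+2-k≡2 = trans (∣-∣-comm (suc (suc k)) k) (trans (cong ∣ k -_∣ (+-comm 2 k)) (∣m-m+n∣≡n k 2))
        cover : ∀ {y} → Move C x y → y ≡ previous ⊎ y ≡ x ⊎ y ≡ following
        cover (inj₁ y≡x) = inj₂ (inj₁ y≡x)
        cover (inj₂ (inj₁ x+1≡y)) =
          inj₂ (inj₂ (toℕ-injective (trans (sym x+1≡y) (trans (cong suc x≡k+1) (sym (toℕ-fromℕ< k+2<n))))))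
        cover (inj₂ (inj₂ (inj₁ y+1≡x))) =
          inj₁ (toℕ-injective (trans (suc-injective (trans y+1≡x x≡k+1)) (sym (toℕ-fromℕ< k<n))))
        cover (inj₂ (inj₂ (inj₂ (inj₁ (x≡0 , _))))) with trans (sym x≡k+1) x≡0
        ... | ()
        cover (inj₂ (inj₂ (inj₂ (inj₂ (_ , x+1≡n))))) =
          ⊥-elim (k+1≢n′ (suc-injective (trans (cong suc (sym x≡k+1)) x+1≡n)))

    separating : Separating metric
    separating = separating-from-neighbourhoods neighbourhood
      where
      neighbourhood : ∀ x → Neighbourhood metric x
      neighbourhood x = classify (toℕ x) refl
        where
        classify : ∀ k → toℕ x ≡ k → Neighbourhood metric x
        classify zero x≡0 = origin-neighbourhood x≡0
        classify (suc k) x≡k+1 with suc k ≟ n′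
        ... | yes k+1≡n′ = last-neighbourhood x≡k+1 k+1≡n′
        ... | no k+1≢n′ = inner-neighbourhood x≡k+1 k+1≢n′

-- The antipode c is ⌈n/2⌉, and the slope s of a region encodes d(i,0) − d(i,1) = 1 − s.
module CycleResolver (h′ c : ℕ) (h≤c : suc h′ ≤ c) (c≤h+1 : c ≤ suc (suc h′)) where
  h = suc h′
  open Cycles (h′ + c)

  1<n : 1 < n
  1<n = s≤s (≤-trans (s≤s z≤n) (≤-trans h≤c (m≤n+m c h′)))

  c<n : c < n
  c<n = s≤s (m≤n+m c h′)

  one antipode : Fin n
  one = fromℕ< 1<n
  antipode = fromℕ< c<n

  data Position (i : Fin n) : ℕ → Set where
    ascending  : toℕ i ≡ d i 0F → d i 0F + d i antipode ≡ c → Position i 0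
    antipodal  : toℕ i ≡ c → Position i 1
    origin     : toℕ i ≡ 0 → d i 0F ≡ 0 → d i 0F + d i antipode ≡ h → Position i 2
    descending : toℕ i + d i 0F ≡ n → d i 0F + d i antipode ≡ h → Position i 2

  record Region (i : Fin n) : Set where
    field
      slope    : ℕ
      slope-eq : d i 0F + slope ≡ d i one + 1
      position : Position i slope
  open Region

  origin-region : ∀ {i} → toℕ i ≡ 0 → Region i
  origin-region {i} i≡0 = record
    { slope = 2 ; slope-eq = trans (cong (_+ 2) d₀) (cong (_+ 1) (sym d₁))
    ; position = origin i≡0 d₀ (cong₂ _+_ d₀ dc) }
    where
    d₀ : d i 0F ≡ 0
    d₀ = d-at i≡0 refl
    d₁ : d i one ≡ 1
    d₁ = trans (d-at i≡0 (toℕ-fromℕ< 1<n)) (cyclic-small 1 1<n)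
    dc : d i antipode ≡ h
    dc = trans (d-at i≡0 (toℕ-fromℕ< c<n)) (trans (cyclic-large c (+-monoˡ-≤ c h≤c)) (m+n∸n≡m h c))

  ascending-region : ∀ {i y} → toℕ i ≡ suc y → suc y ≤ h → Region i
  ascending-region {i} {y} i≡y+1 y+1≤h = record
    { slope = 0
    ; slope-eq = trans (cong (_+ 0) d₀) (trans (sym (+-suc y 0)) (cong (_+ 1) (sym d₁)))
    ; position = ascending (trans i≡y+1 (sym d₀)) (trans (cong₂ _+_ d₀ dc) (m+[n∸m]≡n y+1≤c)) }
    where
    y+1≤c : suc y ≤ c
    y+1≤c = ≤-trans y+1≤h h≤c
    small : suc y + suc y ≤ n
    small = +-mono-≤ y+1≤h y+1≤c
    d₀ : d i 0F ≡ suc y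
    d₀ = trans (d-at i≡y+1 refl) (cyclic-small (suc y) small)
    d₁ : d i one ≡ y
    d₁ = trans (d-at i≡y+1 (toℕ-fromℕ< 1<n))
               (trans (cong cyclic (∣-∣-identityʳ y))
                      (cyclic-small y (≤-trans (+-mono-≤ (n≤1+n y) (n≤1+n y)) small)))
    c-y-1≤h : c ∸ suc y ≤ h
    c-y-1≤h = m≤n+o⇒m∸n≤o c (suc y) (≤-trans c≤h+1 (s≤s (m≤n+m h y)))
    dc : d i antipode ≡ c ∸ suc y
    dc = trans (d-at i≡y+1 (toℕ-fromℕ< c<n))
               (trans (cong cyclic (m≤n⇒∣m-n∣≡n∸m y+1≤c))
                      (cyclic-small _ (+-mono-≤ c-y-1≤h (m∸n≤m c (suc y)))))

  antipodal-region : ∀ {i} → toℕ i ≡ c → c ≡ suc h → Region i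
  antipodal-region {i} i≡c c≡h+1 = record
    { slope = 1 ; slope-eq = trans (cong (_+ 1) d₀) (cong (_+ 1) (sym d₁)) ; position = antipodal i≡c }
    where
    d₀ : d i 0F ≡ h
    d₀ = trans (d-at i≡c refl)
               (trans (cong cyclic (∣-∣-identityʳ c))
                      (trans (cyclic-large c (+-monoˡ-≤ c h≤c)) (m+n∸n≡m h c)))
    d₁ : d i one ≡ h
    d₁ = trans (d-at (trans i≡c c≡h+1) (toℕ-fromℕ< 1<n))
               (trans (cong cyclic (∣-∣-identityʳ h)) (cyclic-small h (+-monoʳ-≤ h h≤c)))

  descending-region : ∀ {i y} → toℕ i ≡ suc y → c < suc y → Region i
  descending-region {i} {y} i≡y+1 c<y+1 = record
    { slope = 2
    ; slope-eq = trans (cong (_+ 2) d₀)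
                       (trans (+-suc (h′ + c ∸ y) 1) (cong (_+ 1) (sym (trans d₁ (+-∸-assoc 1 y≤n-1)))))
    ; position = descending (trans (cong₂ _+_ i≡y+1 d₀) (m+[n∸m]≡n y+1≤n)) sum }
    where
    y+1≤n : suc y ≤ n
    y+1≤n = <⇒≤ (subst (_< n) i≡y+1 (toℕ<n i))
    y≤n-1 : y ≤ h′ + c
    y≤n-1 = s≤s⁻¹ y+1≤n
    c≤y : c ≤ y
    c≤y = s≤s⁻¹ c<y+1
    d₀ : d i 0F ≡ n ∸ suc y
    d₀ = trans (d-at i≡y+1 refl) (cyclic-large (suc y) (+-mono-≤ (≤-trans h≤c (<⇒≤ c<y+1)) (<⇒≤ c<y+1)))
    d₁ : d i one ≡ n ∸ y
    d₁ = trans (d-at i≡y+1 (toℕ-fromℕ< 1<n))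
               (trans (cong cyclic (∣-∣-identityʳ y)) (cyclic-large y (+-mono-≤ (≤-trans h≤c c≤y) c≤y)))
    y+1-c≤h : suc y ∸ c ≤ h
    y+1-c≤h = m≤n+o⇒m∸n≤o (suc y) c (≤-trans y+1≤n (≤-reflexive (+-comm h c)))
    dc : d i antipode ≡ suc y ∸ c
    dc = trans (d-at i≡y+1 (toℕ-fromℕ< c<n))
               (trans (cong cyclic (m≤n⇒∣n-m∣≡n∸m (<⇒≤ c<y+1)))
                      (cyclic-small _ (+-mono-≤ y+1-c≤h (≤-trans y+1-c≤h h≤c))))
    sum : d i 0F + d i antipode ≡ h
    sum = +-cancelʳ-≡ c _ h (begin
      d i 0F + d i antipode + c      ≡⟨ cong₂ (λ u v → u + v + c) d₀ dc ⟩
      (n ∸ suc y) + (suc y ∸ c) + c  ≡⟨ +-assoc (n ∸ suc y) _ c ⟩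
      (n ∸ suc y) + (suc y ∸ c + c)  ≡⟨ cong ((n ∸ suc y) +_) (m∸n+n≡m (<⇒≤ c<y+1)) ⟩
      (n ∸ suc y) + suc y            ≡⟨ m∸n+n≡m y+1≤n ⟩
      h + c                          ∎)
      where open ≡-Reasoning

  region : ∀ i → Region i
  region i = classify (toℕ i) refl
    where
    classify : ∀ x → toℕ i ≡ x → Region i
    classify zero i≡0 = origin-region i≡0
    classify (suc y) i≡y+1 with suc y ≤? h
    ... | yes y+1≤h = ascending-region i≡y+1 y+1≤h
    ... | no y+1≰h with suc y ≟ c
    ...   | yes y+1≡c = antipodal-region (trans i≡y+1 y+1≡c)
                          (≤-antisym c≤h+1 (≤-trans (≰⇒> y+1≰h) (≤-reflexive y+1≡c)))
    ...   | no y+1≢c = descending-region i≡y+1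
                         (≤∧≢⇒< (≤-trans c≤h+1 (≰⇒> y+1≰h)) (y+1≢c ∘ sym))

  origin-descending : ∀ {i i'} → d i 0F ≡ 0 → toℕ i' + d i' 0F ≡ n → d i 0F ≡ d i' 0F → ⊥
  origin-descending {i} {i'} d₀≡0 i'+d₀′≡n e =
    <-irrefl (trans (sym (+-identityʳ (toℕ i'))) (trans (cong (toℕ i' +_) (trans (sym d₀≡0) e)) i'+d₀′≡n))
             (toℕ<n i')

  same-position : ∀ {i i' s} → Position i s → Position i' s → Balanced metric i i' 0F antipode → i ≡ i'
  same-position (ascending i≡d₀ sum) (ascending i'≡d₀′ sum') b =
    toℕ-injective (trans i≡d₀ (trans (balanced-sum b sum sum') (sym i'≡d₀′)))
  same-position (antipodal i≡c) (antipodal i'≡c) _ = toℕ-injective (trans i≡c (sym i'≡c))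
  same-position (origin i≡0 _ _) (origin i'≡0 _ _) _ = toℕ-injective (trans i≡0 (sym i'≡0))
  same-position {i} {i'} (origin _ d₀≡0 sum) (descending i'+d₀′≡n sum') b =
    ⊥-elim (origin-descending {i} {i'} d₀≡0 i'+d₀′≡n (balanced-sum b sum sum'))
  same-position {i} {i'} (descending i+d₀≡n sum) (origin _ d₀′≡0 sum') b =
    ⊥-elim (origin-descending {i'} {i} d₀′≡0 i+d₀≡n (balanced-sum (sym b) sum' sum))
  same-position {i} {i'} (descending i+d₀≡n sum) (descending i'+d₀′≡n sum') b =
    toℕ-injective (+-cancelʳ-≡ (d i 0F) (toℕ i) (toℕ i')
      (trans i+d₀≡n (trans (sym i'+d₀′≡n) (cong (toℕ i' +_) (sym (balanced-sum b sum sum'))))))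

  resolver : ShiftResolver metric
  resolver = record { ℓ₁ = 0F ; ℓ₂ = one ; ℓ₃ = antipode ; resolves = resolves }
    where
    resolves : ∀ {i i'} → Balanced metric i i' 0F one → Balanced metric i i' 0F antipode → i ≡ i'
    resolves {i} {i'} b₁ bc = same-position (position (region i))
      (subst (Position i') (sym (balanced-slope b₁ (slope-eq (region i)) (slope-eq (region i'))))
             (position (region i'))) bc

-- Products of paths and cycles
triangle-wins : CopWins (Cycle 3 □ Cycle 3) 3
triangle-wins = TwoRound.wins M R (λ _ → R) (λ _ _ _ → R-injective _ _)
  where
  M = □-metric (Cycles.metric 2) (Cycles.metric 2)
  open Metric M using (response)
  R : Vec (Fin 3 × Fin 3) 3
  R = (0F , 0F) ∷ (0F , 1F) ∷ (1F , 0F) ∷ []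
  -- R is a resolving set, checked by evaluating the decision procedure on all 81 pairs.
  R-injective : ∀ y y' → response R y ≡ response R y' → y ≡ y'
  R-injective (i , j) (i' , j') = from-yes
    (all? λ i → all? λ j → all? λ i' → all? λ j' →
      ≡-dec _≟_ (response R (i , j)) (response R (i' , j')) →-dec ×-≡-dec _≟ᶠ_ _≟ᶠ_ (i , j) (i' , j'))
    i j i' j'

record Factor (G : Graph) : Set₁ where
  field
    metric                 : Metric G
    searchable             : Searchable (V G)
    resolver               : ShiftResolver metric
    separating-or-triangle : Separating metric ⊎ G ≡ Cycle 3
open Factor

□-wins-factors : ∀ {G H} (FG : Factor G) (FH : Factor H) →
                 Separating (metric FG) ⊎ G ≡ Cycle 3 → Separating (metric FH) ⊎ H ≡ Cycle 3 →
                 CopWins (G □ H) 3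
□-wins-factors FG FH (inj₁ sepG) _ = □-wins (resolver FG) (resolver FH) (searchable FG) sepG
□-wins-factors FG FH (inj₂ _) (inj₁ sepH) =
  CopWins-≅ □-comm (□-wins (resolver FH) (resolver FG) (searchable FH) sepH)
□-wins-factors _ _ (inj₂ refl) (inj₂ refl) = triangle-wins

path-factor : ∀ n′ → Factor (Path (suc n′))
path-factor n′ = record { metric = Paths.metric n′ ; searchable = any? ; resolver = Paths.resolver n′
                        ; separating-or-triangle = inj₁ (Paths.separating n′) }

halves : ∀ n → ∃[ h ] ∃[ c ] (h ≤ c × c ≤ suc h × n ≡ h + c)
halves zero = 0 , 0 , z≤n , z≤n , refl
halves (suc n) with halves n
... | h , c , h≤c , c≤h+1 , refl =
  c , suc h , c≤h+1 , s≤s h≤c , trans (cong suc (+-comm h c)) (sym (+-suc c h))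

cycle-factor : ∀ n → 3 ≤ n → Factor (Cycle n)
cycle-factor n 3≤n with halves n
... | zero , c , _ , c≤1 , refl = ⊥-elim (<⇒≱ 3≤n (≤-trans c≤1 (s≤s z≤n)))
... | suc h′ , c , h≤c , c≤h+1 , refl = record
  { metric = Cycles.metric (h′ + c) ; searchable = any?
  ; resolver = CycleResolver.resolver h′ c h≤c c≤h+1
  ; separating-or-triangle = separating-or-triangle′ }
  where
  separating-or-triangle′ : Separating (Cycles.metric (h′ + c)) ⊎ Cycle (suc h′ + c) ≡ Cycle 3
  separating-or-triangle′ with 3 ≤? h′ + c
  ... | yes 3≤n′ = inj₁ (Cycles.separating (h′ + c) 3≤n′)
  ... | no 3≰n′ = inj₂ (cong (Cycle ∘ suc) (≤-antisym (s≤s⁻¹ (≰⇒> 3≰n′)) (s≤s⁻¹ 3≤n)))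

factor : ∀ {G} → IsPathOrCycle G → Factor G
factor (inj₁ (suc n′ , _ , refl)) = path-factor n′
factor (inj₂ (n , 3≤n , refl)) = cycle-factor n 3≤n

corollary5p9 : (G H : Graph) → IsPathOrCycle G → IsPathOrCycle H → ζ≤ (G □ H) 3
corollary5p9 G H pG pH =
  3 , s≤s z≤n , ≤-refl , □-wins-factors (factor pG) (factor pH) (separating-or-triangle (factor pG))
                                                                (separating-or-triangle (factor pH))
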